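{- Let $k\ge 1$. Consider $k+1$ groups of uniform machines $G_0,\dots,G_k$, where every machine of $G_j$ has speed $2^{ -j}$, $|G_0|=m_0=1$ and $|G_j|=m_j=\sum_{t=0}^{j-1}m_t2^{j-t}$ for $1\le j\le k$. Let $\sigma$ be the strategy profile (and the instance consisting of exactly these jobs) in which each machine of $G_j$ ($0\le j\le k$) receives $2$ jobs of length $2^{ -j}$ and, for each $i$ with $j<i\le k$, $2^{i-j}$ jobs of length $2^{ -i}$. Then, under the EQUI policy, $\sigma$ is a strong Nash equilibrium.
   Context: Uniform machines: each job $i$ has length $p_i$, each machine $j$ has speed $s_j$, and the processing time of $i$ on $j$ is $p_i/s_j$. Under EQUI the cost of job $i$ on machine $j$ is $c_i=\sum_{i'\text{ on }j}\min\{p_i,p_{i'}\}/s_j$ (the sum includes $i$). A strong Nash equilibrium is a profile in which no nonempty coalition of jobs can simultaneously change machines so that every member strictly decreases its cost. -}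

module Defs where

open import Data.Nat as ℕ using (ℕ; zero; suc; _∸_; _^_)
open import Data.Nat.ListAction using (sum)
open import Data.Fin using (Fin)
open import Data.Fin.Properties using (_≟_)
open import Data.Fin.Subset using (Subset; _∈_; _∉_)
open import Data.Bool using (Bool; true; false; if_then_else_)
open import Data.List using (List; []; _∷_; _++_; length; lookup; map; zip; zipWith; concatMap; replicate; upTo; applyUpTo; allFin)
open import Data.Product using (_×_; _,_; proj₁; proj₂; ∃)
open import Data.Rational using (ℚ; 0ℚ; 1ℚ; ½; _*_; _+_; _⊓_; _÷_; _<_; Positive)
open import Data.Rational.Properties using (pos⇒nonZero; pos*pos⇒pos)
open import Relation.Nullary using (¬_; does)
open import Relation.Binary.PropositionalEquality using (_≡_)

record Instance : Set where
  field
    nJobs     : ℕ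
    nMachines : ℕ
    len       : Fin nJobs → ℚ
    speed     : Fin nMachines → ℚ
    speedPos  : ∀ j → Positive (speed j)

open Instance public

Profile : Instance → Set
Profile I = Fin (nJobs I) → Fin (nMachines I)

sumFin : (n : ℕ) → (Fin n → ℚ) → ℚ
sumFin zero    f = 0ℚ
sumFin (suc n) f = f Fin.zero + sumFin n (λ i → f (Fin.suc i))

cost : (I : Instance) → Profile I → Fin (nJobs I) → ℚ
cost I σ i =
  _÷_ (sumFin (nJobs I) (λ i' → if does (σ i' ≟ σ i) then len I i ⊓ len I i' else 0ℚ))
      (speed I (σ i)) {{pos⇒nonZero (speed I (σ i)) {{speedPos I (σ i)}}}}

StrongNE : (I : Instance) → Profile I → Set
StrongNE I σ =
  (C : Subset (nJobs I)) (σ' : Profile I) →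
  ∃ (λ i → i ∈ C) →
  (∀ i → i ∉ C → σ' i ≡ σ i) →
  ¬ (∀ i → i ∈ C → cost I σ' i < cost I σ i)

halfPow : ℕ → ℚ
halfPow zero    = 1ℚ
halfPow (suc j) = ½ * halfPow j

halfPow-pos : ∀ j → Positive (halfPow j)
halfPow-pos zero    = _
halfPow-pos (suc j) = pos*pos⇒pos ½ (halfPow j) {{halfPow-pos j}}

-- groupSizes j = [m_0, …, m_j] with m_0 = 1 and
-- m_j = Σ_{t=0}^{j-1} m_t 2^{j-t}
groupSizes : ℕ → List ℕ
groupSizes zero    = 1 ∷ []
groupSizes (suc j) =
  groupSizes j ++ (sum (zipWith (λ t mt → mt ℕ.* 2 ^ (suc j ∸ t)) (upTo (suc j)) (groupSizes j)) ∷ [])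

-- list of machines (each given by its group index j) of G_0, …, G_k
machineGroups : ℕ → List ℕ
machineGroups k = concatMap (λ jm → replicate (proj₂ jm) (proj₁ jm)) (zip (upTo (suc k)) (groupSizes k))

-- exponents e of the lengths 2^{-e} of the jobs placed on a machine of G_j:
-- 2 jobs with e = j, and 2^{i-j} jobs with e = i for each j < i ≤ k
jobsOnGroup : ℕ → ℕ → List ℕ
jobsOnGroup k j = replicate 2 j ++ concatMap (λ i → replicate (2 ^ (i ∸ j)) i) (applyUpTo (λ d → suc j ℕ.+ d) (k ∸ j))

nMach : ℕ → ℕ
nMach k = length (machineGroups k)

-- the jobs as pairs (length exponent e, machine that receives the job in σ)
jobList : (k : ℕ) → List (ℕ × Fin (nMach k))
jobList k = concatMap (λ r → map (λ e → e , r) (jobsOnGroup k (lookup (machineGroups k) r)))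
                      (allFin (nMach k))

inst : ℕ → Instance
inst k = record
  { nJobs     = length (jobList k)
  ; nMachines = nMach k
  ; len       = λ i → halfPow (proj₁ (lookup (jobList k) i))
  ; speed     = λ r → halfPow (lookup (machineGroups k) r)
  ; speedPos  = λ r → halfPow-pos (lookup (machineGroups k) r)
  }

sigma : (k : ℕ) → Profile (inst k)
sigma k i = proj₂ (lookup (jobList k) i)

-- Measure lengths in units of 2^-k and replace speeds by their inverses, so that all EQUI
-- costs become natural numbers. In σ a job of length 2^-e pays k - e + 2 wherever it sits,
-- while a job of length p joining a machine r of group g would pay at least that plus
-- min(p, 2^-g) · 2^g. Given a deviating coalition, take for a machine r receiving members the
-- shortest incoming member i₀; comparing the jobs on r before and after the deviation one by
-- one shows that i₀ gains nothing unless r ends up with fewer jobs. Hence every machine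
-- receiving a member loses jobs and no other machine gains any, which is impossible since
-- the number of jobs is fixed.

module Submission where

open import Defs

open import Algebra.Bundles using (Ring)
open import Data.Bool.Base using (Bool; true; false; if_then_else_)
open import Data.Empty using (⊥-elim)
open import Data.Fin.Base using (Fin; zero; suc; toℕ)
open import Data.Fin.Properties using (_≟_; any?)
open import Data.Fin.Subset using (Subset; _∈_; _∉_)
open import Data.Fin.Subset.Properties using (_∈?_)
open import Data.List.Base using (List; []; _∷_; _++_; length; lookup; map; concatMap; replicate; applyUpTo; tabulate; allFin; zip)
open import Data.List.Properties using (map-++; map-cong; map-∘)
open import Data.List.Membership.Propositional.Properties using (∈-lookup)
open import Data.List.Relation.Unary.All as All using (All; []; _∷_)
open import Data.List.Relation.Unary.All.Properties using (++⁺; concat⁺; map⁺; replicate⁺; applyUpTo⁺₁; tabulate⁺; all-upTo)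
open import Data.Nat.Base using (ℕ; zero; suc; _+_; _*_; _∸_; _^_; _⊓_; _≤_; _<_; z≤n; s≤s)
open import Data.Nat.Induction using (<-wellFounded)
open import Data.Nat.ListAction using (sum)
open import Data.Nat.ListAction.Properties using (sum-++)
open import Data.Nat.Properties hiding (_≟_)
open import Data.Nat.Tactic.RingSolver using (solve-∀)
open import Data.Product using (_×_; _,_; proj₁; proj₂; ∃; ∃-syntax)
open import Data.Rational.Base as ℚ using (ℚ; 0ℚ; 1ℚ; ½)
import Data.Rational.Properties as ℚ
open import Data.Sum using (inj₁; inj₂)
open import Function.Base using (_∘_; id)
open import Induction.WellFounded using (Acc; acc)
open import Relation.Nullary using (¬_; does; yes; no; _×-dec_)
open import Relation.Unary using (Pred; Decidable)
open import Relation.Binary.PropositionalEquality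

open import Algebra.Properties.Semiring.Sum +-*-semiring
  using (sum-syntax; sum-cong-≗; sum-replicate-zero; ∑-distrib-+; ∑-comm; *-distribˡ-sum; *-distribʳ-sum)
  renaming (sum to ∑)
open import Algebra.Properties.Semiring.Mult (Ring.semiring ℚ.+-*-ring)
  using (×-homo-+; ×-assocˡ; ×-comm-*; ×-assoc-*) renaming (_×_ to infix 7 _·_)

∑-mono-≤ : ∀ {n} {f g : Fin n → ℕ} → (∀ j → f j ≤ g j) → ∑ f ≤ ∑ g
∑-mono-≤ {zero}  f≤g = z≤n
∑-mono-≤ {suc n} f≤g = +-mono-≤ (f≤g zero) (∑-mono-≤ (f≤g ∘ suc))

∑-mono-< : ∀ {n} {f g : Fin n → ℕ} → (∀ j → f j ≤ g j) → ∀ i → f i < g i → ∑ f < ∑ g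
∑-mono-< f≤g zero    fi<gi = +-mono-<-≤ fi<gi (∑-mono-≤ (f≤g ∘ suc))
∑-mono-< f≤g (suc i) fi<gi = +-mono-≤-< (f≤g zero) (∑-mono-< (f≤g ∘ suc) i fi<gi)

∑-indicatorˡ : ∀ {n} (i : Fin n) (c : Fin n → ℕ) → ∑[ j < n ] (if does (j ≟ i) then c j else 0) ≡ c i
∑-indicatorˡ {suc n} zero    c = trans (cong (c zero +_) (sum-replicate-zero n)) (+-identityʳ (c zero))
∑-indicatorˡ {suc n} (suc i) c = ∑-indicatorˡ i (c ∘ suc)

∑-indicatorʳ : ∀ {n} (i : Fin n) (c : Fin n → ℕ) → ∑[ j < n ] (if does (i ≟ j) then c j else 0) ≡ c i
∑-indicatorʳ {suc n} zero    c = trans (cong (c zero +_) (sum-replicate-zero n)) (+-identityʳ (c zero))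
∑-indicatorʳ {suc n} (suc i) c = ∑-indicatorʳ i (c ∘ suc)

∑-if-const : ∀ {n} (b : Fin n → Bool) c → ∑[ j < n ] (if b j then c else 0) ≡ ∑[ j < n ] (if b j then 1 else 0) * c
∑-if-const b c = sym (trans (*-distribʳ-sum c (λ j → if b j then 1 else 0)) (sum-cong-≗ scale))
  where
  scale : ∀ j → (if b j then 1 else 0) * c ≡ (if b j then c else 0)
  scale j with b j
  ... | true  = +-identityʳ c
  ... | false = refl

∑-ones : ∀ n → ∑[ j < n ] 1 ≡ n
∑-ones zero    = refl
∑-ones (suc n) = cong suc (∑-ones n)

minimal-witness : ∀ {n p} {P : Pred (Fin n) p} → Decidable P → (w : Fin n → ℕ) → ∃ P →
                  ∃[ i ] P i × (∀ j → P j → w i ≤ w j)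
minimal-witness {P = P} P? w (i , Pi) = descend i Pi (<-wellFounded (w i))
  where
  descend : ∀ i → P i → Acc _<_ (w i) → ∃[ i ] P i × (∀ j → P j → w i ≤ w j)
  descend i Pi (acc smaller) with any? (λ j → P? j ×-dec w j <? w i)
  ... | yes (j , Pj , wj<wi) = descend j Pj (smaller wj<wi)
  ... | no none              = i , Pi , λ j Pj → ≮⇒≥ (λ wj<wi → none (j , Pj , wj<wi))

-- Job lengths P and inverse speeds G as natural numbers in a common unit, so that
-- equiCost is the EQUI cost in that unit.
module Equi {n m : ℕ} (P : Fin n → ℕ) (G : Fin m → ℕ) where

  equiLoad : (Fin n → Fin m) → Fin m → ℕ → ℕ
  equiLoad τ r p = ∑[ j < n ] (if does (τ j ≟ r) then p ⊓ P j else 0)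

  equiCost : (Fin n → Fin m) → Fin n → ℕ
  equiCost τ i = equiLoad τ (τ i) (P i) * G (τ i)

  occupancy : (Fin n → Fin m) → Fin m → ℕ
  occupancy τ r = ∑[ j < n ] (if does (τ j ≟ r) then 1 else 0)

  ∑-occupancy : ∀ τ → ∑[ r < m ] occupancy τ r ≡ n
  ∑-occupancy τ = begin
    ∑[ r < m ] ∑[ j < n ] (if does (τ j ≟ r) then 1 else 0) ≡⟨ ∑-comm (λ r j → if does (τ j ≟ r) then 1 else 0) ⟩
    ∑[ j < n ] ∑[ r < m ] (if does (τ j ≟ r) then 1 else 0) ≡⟨ sum-cong-≗ (λ j → ∑-indicatorʳ (τ j) (λ _ → 1)) ⟩
    ∑[ j < n ] 1                                            ≡⟨ ∑-ones n ⟩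
    n                                                       ∎
    where open ≡-Reasoning

  IsStrongNE : (Fin n → Fin m) → Set
  IsStrongNE σ = (C : Subset n) (σ′ : Fin n → Fin m) → ∃ (_∈ C) → (∀ i → i ∉ C → σ′ i ≡ σ i) →
                 ¬ (∀ i → i ∈ C → equiCost σ′ i < equiCost σ i)

  -- U r bounds the lengths of the jobs σ places on r, and by `margin` a job moving alone
  -- to r would pay at least its cost in σ plus (P j ⊓ U r) * G r.
  module _ (U : Fin m → ℕ) (σ : Fin n → Fin m)
           (fits : ∀ j → P j ≤ U (σ j))
           (margin : ∀ r j → equiCost σ j + (P j ⊓ U r) * G r ≤ (equiLoad σ r (P j) + P j) * G r)
           where

    module _ {C : Subset n} {σ′ : Fin n → Fin m} (stay : ∀ i → i ∉ C → σ′ i ≡ σ i) where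

      arrival∈C : ∀ {j r} → σ′ j ≡ r → σ j ≢ r → j ∈ C
      arrival∈C {j} σ′j≡r σj≢r with j ∈? C
      ... | yes j∈C = j∈C
      ... | no  j∉C = ⊥-elim (σj≢r (trans (sym (stay j j∉C)) σ′j≡r))

      occupancy-≤-without-arrivals : ∀ r → ¬ (∃[ j ] j ∈ C × σ′ j ≡ r) → occupancy σ′ r ≤ occupancy σ r
      occupancy-≤-without-arrivals r no-arrival = ∑-mono-≤ pointwise
        where
        pointwise : ∀ j → (if does (σ′ j ≟ r) then 1 else 0) ≤ (if does (σ j ≟ r) then 1 else 0)
        pointwise j with σ′ j ≟ r | σ j ≟ r
        ... | yes _     | yes _   = ≤-refl
        ... | no  _     | _       = z≤n
        ... | yes σ′j≡r | no σj≢r = ⊥-elim (no-arrival (j , arrival∈C σ′j≡r σj≢r , σ′j≡r))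

      module _ (i₀ : Fin n) (lightest : ∀ j → j ∈ C → σ′ j ≡ σ′ i₀ → P i₀ ≤ P j) where

        private
          r : Fin m
          r = σ′ i₀
          p q : ℕ
          p = P i₀
          q = p ⊓ U r

        -- Charge q per job on r: a job leaving r shared at most q with i₀, while a coalition
        -- member arriving at r is no shorter than i₀ and shares p ≥ q.
        exchange : ∀ j → (if does (σ j ≟ r) then p ⊓ P j else 0) + (if does (j ≟ i₀) then p else 0) + (if does (σ′ j ≟ r) then q else 0)
                       ≤ (if does (σ′ j ≟ r) then p ⊓ P j else 0) + (if does (j ≟ i₀) then q else 0) + (if does (σ j ≟ r) then q else 0)
        exchange j with j ≟ i₀ | σ j ≟ r | σ′ j ≟ r
        ... | yes refl | _        | no off   = ⊥-elim (off refl)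
        ... | yes refl | yes σi₀≡r | yes _   = +-monoˡ-≤ q (+-monoʳ-≤ (p ⊓ p) p≤q)
          where
          p≤q : p ≤ q
          p≤q = ≤-reflexive (sym (m≤n⇒m⊓n≡m (subst (λ s → p ≤ U s) σi₀≡r (fits i₀))))
        ... | yes refl | no  _    | yes _    = ≤-reflexive (sym (trans (+-identityʳ (p ⊓ p + q)) (cong (_+ q) (⊓-idem p))))
        ... | no  _    | yes _    | yes _    = ≤-refl
        ... | no  _    | yes σj≡r | no  _    rewrite +-identityʳ (p ⊓ P j) | +-identityʳ (p ⊓ P j) =
          ⊓-monoʳ-≤ p (subst (λ s → P j ≤ U s) σj≡r (fits j))
        ... | no  _    | no  σj≢r | yes σ′j≡r rewrite +-identityʳ (p ⊓ P j) | +-identityʳ (p ⊓ P j) =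
          ≤-trans (m⊓n≤m p (U r)) (≤-reflexive (sym (m≤n⇒m⊓n≡m (lightest j (arrival∈C σ′j≡r σj≢r) σ′j≡r))))
        ... | no  _    | no  _    | no  _    = z≤n

        exchange-summed : equiLoad σ r p + p + occupancy σ′ r * q ≤ equiLoad σ′ r p + q + occupancy σ r * q
        exchange-summed = subst₂ _≤_ (∑-split (λ j → does (σ j ≟ r)) (λ j → does (σ′ j ≟ r)) p)
                                     (∑-split (λ j → does (σ′ j ≟ r)) (λ j → does (σ j ≟ r)) q)
                                     (∑-mono-≤ exchange)
          where
          ∑-split : ∀ (a b : Fin n → Bool) x →
                    ∑[ j < n ] ((if a j then p ⊓ P j else 0) + (if does (j ≟ i₀) then x else 0) + (if b j then q else 0))
                    ≡ ∑[ j < n ] (if a j then p ⊓ P j else 0) + x + ∑[ j < n ] (if b j then 1 else 0) * q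
          ∑-split a b x = trans (∑-distrib-+ (λ j → A j + D j) (λ j → if b j then q else 0))
                            (cong₂ _+_ (trans (∑-distrib-+ A D) (cong (∑ A +_) (∑-indicatorˡ i₀ (λ _ → x))))
                                       (∑-if-const b q))
            where
            A D : Fin n → ℕ
            A j = if a j then p ⊓ P j else 0
            D j = if does (j ≟ i₀) then x else 0

        lightest-arrival-no-gain : occupancy σ r ≤ occupancy σ′ r → equiCost σ i₀ ≤ equiCost σ′ i₀
        lightest-arrival-no-gain occ≤ = +-cancelʳ-≤ (q * G r) _ _ (begin
          equiCost σ i₀ + q * G r        ≤⟨ margin r i₀ ⟩
          (equiLoad σ r p + p) * G r     ≤⟨ *-monoˡ-≤ (G r) load-bound ⟩
          (equiLoad σ′ r p + q) * G r    ≡⟨ *-distribʳ-+ (G r) (equiLoad σ′ r p) q ⟩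
          equiCost σ′ i₀ + q * G r       ∎)
          where
          open ≤-Reasoning
          load-bound : equiLoad σ r p + p ≤ equiLoad σ′ r p + q
          load-bound = +-cancelʳ-≤ (occupancy σ′ r * q) _ _
            (≤-trans exchange-summed (+-monoʳ-≤ (equiLoad σ′ r p + q) (*-monoˡ-≤ q occ≤)))

    strongNE-criterion : IsStrongNE σ
    strongNE-criterion C σ′ (i , i∈C) stay improves =
      <-irrefl (trans (∑-occupancy σ′) (sym (∑-occupancy σ))) (∑-mono-< occupancy-≤ (σ′ i) (vacated (σ′ i) i∈C refl))
      where
      vacated : ∀ {j} r → j ∈ C → σ′ j ≡ r → occupancy σ′ r < occupancy σ r
      vacated {j} r j∈C σ′j≡r with minimal-witness (λ x → x ∈? C ×-dec σ′ x ≟ r) P (j , j∈C , σ′j≡r)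
      ... | i₀ , (i₀∈C , refl) , lightest =
        ≰⇒> λ occ≤ → <⇒≱ (improves i₀ i₀∈C)
          (lightest-arrival-no-gain stay i₀ (λ x x∈C σ′x≡r → lightest x (x∈C , σ′x≡r)) occ≤)
      occupancy-≤ : ∀ r → occupancy σ′ r ≤ occupancy σ r
      occupancy-≤ r with any? (λ x → x ∈? C ×-dec σ′ x ≟ r)
      ... | yes (j , j∈C , σ′j≡r) = <⇒≤ (vacated r j∈C σ′j≡r)
      ... | no  no-arrival        = occupancy-≤-without-arrivals stay r no-arrival

-- In units of 2^-k and with q = k - g, a machine of group g carries two jobs of length 2^q
-- and 2^(d+1) jobs of length 2^(q-d-1) for each d < q; machineLoad q p sums min(p, ·) over them.
lowerLoad : ℕ → ℕ → ℕ
lowerLoad q p = ∑[ d < q ] (2 ^ suc (toℕ d) * (p ⊓ 2 ^ (q ∸ suc (toℕ d))))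

machineLoad : ℕ → ℕ → ℕ
machineLoad q p = 2 * (p ⊓ 2 ^ q) + lowerLoad q p

lowerLoad-suc : ∀ q p → lowerLoad (suc q) p ≡ 2 * (p ⊓ 2 ^ q) + 2 * lowerLoad q p
lowerLoad-suc q p = cong (2 * (p ⊓ 2 ^ q) +_) (trans
  (sum-cong-≗ {q} (λ d → *-assoc 2 (2 ^ suc (toℕ d)) (p ⊓ 2 ^ (q ∸ suc (toℕ d)))))
  (sym (*-distribˡ-sum {q} 2 (λ d → 2 ^ suc (toℕ d) * (p ⊓ 2 ^ (q ∸ suc (toℕ d)))))))

lowerLoad-large : ∀ q b → q ≤ b → lowerLoad q (2 ^ b) ≡ q * 2 ^ q
lowerLoad-large zero    b _      = refl
lowerLoad-large (suc q) b 1+q≤b = begin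
  lowerLoad (suc q) (2 ^ b)                     ≡⟨ lowerLoad-suc q (2 ^ b) ⟩
  2 * (2 ^ b ⊓ 2 ^ q) + 2 * lowerLoad q (2 ^ b) ≡⟨ cong₂ (λ u v → 2 * u + 2 * v) (m≥n⇒m⊓n≡n (^-monoʳ-≤ 2 q≤b)) (lowerLoad-large q b q≤b) ⟩
  2 * 2 ^ q + 2 * (q * 2 ^ q)                   ≡⟨ identity q (2 ^ q) ⟩
  suc q * 2 ^ suc q                              ∎
  where
  open ≡-Reasoning
  q≤b : q ≤ b
  q≤b = ≤-trans (n≤1+n q) 1+q≤b
  identity : ∀ q x → 2 * x + 2 * (q * x) ≡ suc q * (2 * x)
  identity = solve-∀

lowerLoad-small : ∀ q b → b ≤ q → lowerLoad q (2 ^ b) + 2 * 2 ^ b ≡ (b + 2) * 2 ^ q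
lowerLoad-small zero    zero    _     = refl
lowerLoad-small (suc q) b       b≤1+q with b ≤? q
... | yes b≤q = begin
  lowerLoad (suc q) (2 ^ b) + 2 * 2 ^ b                     ≡⟨ cong (_+ 2 * 2 ^ b) (lowerLoad-suc q (2 ^ b)) ⟩
  2 * (2 ^ b ⊓ 2 ^ q) + 2 * lowerLoad q (2 ^ b) + 2 * 2 ^ b
    ≡⟨ cong (λ u → 2 * u + 2 * lowerLoad q (2 ^ b) + 2 * 2 ^ b) (m≤n⇒m⊓n≡m (^-monoʳ-≤ 2 b≤q)) ⟩
  2 * 2 ^ b + 2 * lowerLoad q (2 ^ b) + 2 * 2 ^ b           ≡⟨ regroup (2 ^ b) (lowerLoad q (2 ^ b)) ⟩
  2 * (lowerLoad q (2 ^ b) + 2 * 2 ^ b)                     ≡⟨ cong (2 *_) (lowerLoad-small q b b≤q) ⟩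
  2 * ((b + 2) * 2 ^ q)                                     ≡⟨ *-comm-middle 2 (b + 2) (2 ^ q) ⟩
  (b + 2) * 2 ^ suc q                                       ∎
  where
  open ≡-Reasoning
  regroup : ∀ y x → 2 * y + 2 * x + 2 * y ≡ 2 * (x + 2 * y)
  regroup = solve-∀
  *-comm-middle : ∀ a c x → a * (c * x) ≡ c * (a * x)
  *-comm-middle = solve-∀
... | no b≰q with refl ← ≤-antisym b≤1+q (≰⇒> b≰q) = begin
  lowerLoad (suc q) (2 ^ suc q) + 2 * 2 ^ suc q                             ≡⟨ cong (_+ 2 * 2 ^ suc q) (lowerLoad-suc q (2 ^ suc q)) ⟩
  2 * (2 ^ suc q ⊓ 2 ^ q) + 2 * lowerLoad q (2 ^ suc q) + 2 * 2 ^ suc q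
    ≡⟨ cong₂ (λ u v → 2 * u + 2 * v + 2 * 2 ^ suc q) (m≥n⇒m⊓n≡n (^-monoʳ-≤ 2 (n≤1+n q))) (lowerLoad-large q (suc q) (n≤1+n q)) ⟩
  2 * 2 ^ q + 2 * (q * 2 ^ q) + 2 * 2 ^ suc q                               ≡⟨ identity q (2 ^ q) ⟩
  (suc q + 2) * 2 ^ suc q                                                   ∎
  where
  open ≡-Reasoning
  identity : ∀ q x → 2 * x + 2 * (q * x) + 2 * (2 * x) ≡ (suc q + 2) * (2 * x)
  identity = solve-∀

machineLoad-own : ∀ q b → b ≤ q → machineLoad q (2 ^ b) ≡ (b + 2) * 2 ^ q
machineLoad-own q b b≤q = begin
  2 * (2 ^ b ⊓ 2 ^ q) + lowerLoad q (2 ^ b) ≡⟨ cong (λ u → 2 * u + lowerLoad q (2 ^ b)) (m≤n⇒m⊓n≡m (^-monoʳ-≤ 2 b≤q)) ⟩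
  2 * 2 ^ b + lowerLoad q (2 ^ b)           ≡⟨ +-comm (2 * 2 ^ b) (lowerLoad q (2 ^ b)) ⟩
  lowerLoad q (2 ^ b) + 2 * 2 ^ b           ≡⟨ lowerLoad-small q b b≤q ⟩
  (b + 2) * 2 ^ q                           ∎
  where open ≡-Reasoning

machineLoad-large : ∀ q b → q ≤ b → machineLoad q (2 ^ b) ≡ (q + 2) * 2 ^ q
machineLoad-large q b q≤b = begin
  2 * (2 ^ b ⊓ 2 ^ q) + lowerLoad q (2 ^ b) ≡⟨ cong₂ (λ u v → 2 * u + v) (m≥n⇒m⊓n≡n (^-monoʳ-≤ 2 q≤b)) (lowerLoad-large q b q≤b) ⟩
  2 * 2 ^ q + q * 2 ^ q                     ≡⟨ +-comm (2 * 2 ^ q) (q * 2 ^ q) ⟩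
  q * 2 ^ q + 2 * 2 ^ q                     ≡⟨ *-distribʳ-+ (2 ^ q) q 2 ⟨
  (q + 2) * 2 ^ q                           ∎
  where open ≡-Reasoning

2^[k∸g]*2^g : ∀ {k g} → g ≤ k → 2 ^ (k ∸ g) * 2 ^ g ≡ 2 ^ k
2^[k∸g]*2^g {k} {g} g≤k = trans (sym (^-distribˡ-+-* 2 (k ∸ g) g)) (cong (2 ^_) (m∸n+n≡m g≤k))

1+n≤2^n : ∀ t → suc t ≤ 2 ^ t
1+n≤2^n zero    = ≤-refl
1+n≤2^n (suc t) = +-mono-≤ (m^n>0 2 t) (≤-trans (1+n≤2^n t) (m≤m+n (2 ^ t) 0))

deviation-margin : ∀ q b → (b + 2) * 2 ^ q + (2 ^ b ⊓ 2 ^ q) ≤ machineLoad q (2 ^ b) + 2 ^ b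
deviation-margin q b with b ≤? q
... | yes b≤q = ≤-reflexive (cong₂ _+_ (sym (machineLoad-own q b b≤q)) (m≤n⇒m⊓n≡m (^-monoʳ-≤ 2 b≤q)))
... | no  b≰q = begin
  (b + 2) * 2 ^ q + (2 ^ b ⊓ 2 ^ q) ≡⟨ cong₂ (λ u v → (u + 2) * 2 ^ q + v) (sym (m∸n+n≡m q≤b)) (m≥n⇒m⊓n≡n (^-monoʳ-≤ 2 q≤b)) ⟩
  (t + q + 2) * 2 ^ q + 2 ^ q       ≡⟨ regroup t q (2 ^ q) ⟩
  (q + 2) * 2 ^ q + suc t * 2 ^ q   ≤⟨ +-monoʳ-≤ ((q + 2) * 2 ^ q) (*-monoˡ-≤ (2 ^ q) (1+n≤2^n t)) ⟩
  (q + 2) * 2 ^ q + 2 ^ t * 2 ^ q   ≡⟨ cong₂ _+_ (sym (machineLoad-large q b q≤b)) 2^t*2^q≡2^b ⟩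
  machineLoad q (2 ^ b) + 2 ^ b     ∎
  where
  open ≤-Reasoning
  q≤b : q ≤ b
  q≤b = <⇒≤ (≰⇒> b≰q)
  t : ℕ
  t = b ∸ q
  regroup : ∀ t q x → (t + q + 2) * x + x ≡ (q + 2) * x + suc t * x
  regroup = solve-∀
  2^t*2^q≡2^b : 2 ^ t * 2 ^ q ≡ 2 ^ b
  2^t*2^q≡2^b = trans (sym (^-distribˡ-+-* 2 t q)) (cong (2 ^_) (m∸n+n≡m q≤b))

module _ (u : ℚ) .{{_ : ℚ.NonNegative u}} where

  ·-nonNeg : ∀ n → 0ℚ ℚ.≤ n · u
  ·-nonNeg zero    = ℚ.≤-refl
  ·-nonNeg (suc n) = ℚ.+-mono-≤ (ℚ.nonNegative⁻¹ u) (·-nonNeg n)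

  ·-monoˡ-≤ : ∀ {m n} → m ≤ n → m · u ℚ.≤ n · u
  ·-monoˡ-≤ {n = n} z≤n = ·-nonNeg n
  ·-monoˡ-≤ (s≤s m≤n)  = ℚ.+-monoʳ-≤ u (·-monoˡ-≤ m≤n)

  ·-cancelʳ-< : ∀ {m n} → m · u ℚ.< n · u → m < n
  ·-cancelʳ-< mu<nu = ≰⇒> λ n≤m → ℚ.<-irrefl refl (ℚ.<-≤-trans mu<nu (·-monoˡ-≤ n≤m))

  ·-distrib-⊓ : ∀ m n → (m · u) ℚ.⊓ (n · u) ≡ (m ⊓ n) · u
  ·-distrib-⊓ m n with ≤-total m n
  ... | inj₁ m≤n = trans (ℚ.p≤q⇒p⊓q≡p (·-monoˡ-≤ m≤n)) (cong (_· u) (sym (m≤n⇒m⊓n≡m m≤n)))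
  ... | inj₂ n≤m = trans (ℚ.p≥q⇒p⊓q≡q (·-monoˡ-≤ n≤m)) (cong (_· u) (sym (m≥n⇒m⊓n≡n n≤m)))

  sumFin-· : ∀ n {f : Fin n → ℚ} (F : Fin n → ℕ) → (∀ j → f j ≡ F j · u) → sumFin n f ≡ (∑ F) · u
  sumFin-· zero    F f≡Fu = refl
  sumFin-· (suc n) F f≡Fu = trans (cong₂ ℚ._+_ (f≡Fu zero) (sumFin-· n (F ∘ suc) (f≡Fu ∘ suc)))
                                  (sym (×-homo-+ u (F zero) (∑ (F ∘ suc))))

2^·halfPow : ∀ a e → 2 ^ a · halfPow (a + e) ≡ halfPow e
2^·halfPow zero    e = ℚ.+-identityʳ (halfPow e)
2^·halfPow (suc a) e = begin
  (2 * 2 ^ a) · (½ ℚ.* halfPow (a + e)) ≡⟨ ×-assocˡ (½ ℚ.* halfPow (a + e)) 2 (2 ^ a) ⟨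
  2 · (2 ^ a · (½ ℚ.* halfPow (a + e))) ≡⟨ cong (2 ·_) (×-comm-* (2 ^ a) ½ (halfPow (a + e))) ⟨
  2 · (½ ℚ.* (2 ^ a · halfPow (a + e))) ≡⟨ cong (λ x → 2 · (½ ℚ.* x)) (2^·halfPow a e) ⟩
  2 · (½ ℚ.* halfPow e)                 ≡⟨ ×-assoc-* 2 ½ (halfPow e) ⟨
  1ℚ ℚ.* halfPow e                      ≡⟨ ℚ.*-identityˡ (halfPow e) ⟩
  halfPow e                             ∎
  where open ≡-Reasoning

halfPow-in-units : ∀ {k e} → e ≤ k → halfPow e ≡ 2 ^ (k ∸ e) · halfPow k
halfPow-in-units {k} {e} e≤k = sym (subst (λ x → 2 ^ (k ∸ e) · halfPow x ≡ halfPow e) (m∸n+n≡m e≤k) (2^·halfPow (k ∸ e) e))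

1/halfPow : ∀ g .{{_ : ℚ.NonZero (halfPow g)}} → ℚ.1/ halfPow g ≡ 2 ^ g · 1ℚ
1/halfPow g = begin
  ℚ.1/ halfPow g                           ≡⟨ ℚ.*-identityʳ _ ⟨
  ℚ.1/ halfPow g ℚ.* 1ℚ                    ≡⟨ cong (ℚ.1/ halfPow g ℚ.*_) 2^g·halfPow-g ⟨
  ℚ.1/ halfPow g ℚ.* (2 ^ g · halfPow g)   ≡⟨ ×-comm-* (2 ^ g) (ℚ.1/ halfPow g) (halfPow g) ⟩
  2 ^ g · (ℚ.1/ halfPow g ℚ.* halfPow g)   ≡⟨ cong (2 ^ g ·_) (ℚ.*-inverseˡ (halfPow g)) ⟩
  2 ^ g · 1ℚ                               ∎
  where
  open ≡-Reasoning
  2^g·halfPow-g : 2 ^ g · halfPow g ≡ 1ℚ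
  2^g·halfPow-g = subst (λ x → 2 ^ g · halfPow x ≡ 1ℚ) (+-identityʳ g) (2^·halfPow g 0)

sum-map-lookup : ∀ {a} {A : Set a} (xs : List A) (F : A → ℕ) → ∑[ j < length xs ] F (lookup xs j) ≡ sum (map F xs)
sum-map-lookup []       F = refl
sum-map-lookup (x ∷ xs) F = cong (F x +_) (sum-map-lookup xs F)

module _ {a b} {A : Set a} {B : Set b} where

  sum-map-concatMap : ∀ (F : B → ℕ) (G : A → List B) xs →
                      sum (map F (concatMap G xs)) ≡ sum (map (λ x → sum (map F (G x))) xs)
  sum-map-concatMap F G []       = refl
  sum-map-concatMap F G (x ∷ xs) = begin
    sum (map F (G x ++ concatMap G xs))              ≡⟨ cong sum (map-++ F (G x) (concatMap G xs)) ⟩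
    sum (map F (G x) ++ map F (concatMap G xs))      ≡⟨ sum-++ (map F (G x)) (map F (concatMap G xs)) ⟩
    sum (map F (G x)) + sum (map F (concatMap G xs)) ≡⟨ cong (sum (map F (G x)) +_) (sum-map-concatMap F G xs) ⟩
    sum (map F (G x)) + sum (map (λ x → sum (map F (G x))) xs) ∎
    where open ≡-Reasoning

sum-map-replicate : ∀ {a} {A : Set a} (F : A → ℕ) c x → sum (map F (replicate c x)) ≡ c * F x
sum-map-replicate F zero    x = refl
sum-map-replicate F (suc c) x = cong (F x +_) (sum-map-replicate F c x)

sum-map-applyUpTo : ∀ {a} {A : Set a} (F : A → ℕ) (f : ℕ → A) c → sum (map F (applyUpTo f c)) ≡ ∑[ d < c ] F (f (toℕ d))
sum-map-applyUpTo F f zero    = refl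
sum-map-applyUpTo F f (suc c) = cong (F (f 0) +_) (sum-map-applyUpTo F (f ∘ suc) c)

sum-map-tabulate : ∀ {a} {A : Set a} {n} (F : A → ℕ) (t : Fin n → A) → sum (map F (tabulate t)) ≡ ∑[ i < n ] F (t i)
sum-map-tabulate {n = zero}  F t = refl
sum-map-tabulate {n = suc n} F t = cong (F (t zero) +_) (sum-map-tabulate F (t ∘ suc))

sum-map-if : ∀ {a} {A : Set a} b (F : A → ℕ) xs → sum (map (λ x → if b then F x else 0) xs) ≡ (if b then sum (map F xs) else 0)
sum-map-if true  F xs       = refl
sum-map-if false F []       = refl
sum-map-if false F (x ∷ xs) = sum-map-if false F xs

All-zip-proj₁ : ∀ {a b p} {A : Set a} {B : Set b} {P : A → Set p} {xs : List A} (ys : List B) →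
                All P xs → All (P ∘ proj₁) (zip xs ys)
All-zip-proj₁ ys       []         = []
All-zip-proj₁ []       (px ∷ pxs) = []
All-zip-proj₁ (y ∷ ys) (px ∷ pxs) = px ∷ All-zip-proj₁ ys pxs

module Construction (k : ℕ) where

  n m : ℕ
  n = nJobs (inst k)
  m = nMachines (inst k)

  σ : Fin n → Fin m
  σ = sigma k

  group : Fin m → ℕ
  group r = lookup (machineGroups k) r

  exponent : Fin n → ℕ
  exponent j = proj₁ (lookup (jobList k) j)

  size : Fin n → ℕ
  size j = 2 ^ (k ∸ exponent j)

  slowdown : Fin m → ℕ
  slowdown r = 2 ^ group r

  open Equi size slowdown

  group-≤ : ∀ r → group r ≤ k
  group-≤ r = All.lookup groups-≤ (∈-lookup r)
    where
    groups-≤ : All (_≤ k) (machineGroups k)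
    groups-≤ = concat⁺ (map⁺ (All.map (λ g<1+k → replicate⁺ _ (≤-pred g<1+k))
                                       (All-zip-proj₁ (groupSizes k) (all-upTo (suc k)))))

  jobsOnGroup-bounds : ∀ g → g ≤ k → All (λ e → g ≤ e × e ≤ k) (jobsOnGroup k g)
  jobsOnGroup-bounds g g≤k = ++⁺ (replicate⁺ 2 (≤-refl , g≤k))
    (concat⁺ (map⁺ (applyUpTo⁺₁ (λ d → suc g + d) (k ∸ g) λ {d} d<k∸g → replicate⁺ _
      (≤-trans (n≤1+n g) (m≤m+n (suc g) d) ,
       subst (_≤ k) (+-suc g d) (subst (g + suc d ≤_) (m+[n∸m]≡n g≤k) (+-monoʳ-≤ g d<k∸g))))))

  job-bounds : ∀ j → group (σ j) ≤ exponent j × exponent j ≤ k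
  job-bounds j = All.lookup jobs-bounded (∈-lookup j)
    where
    jobs-bounded : All (λ x → group (proj₂ x) ≤ proj₁ x × proj₁ x ≤ k) (jobList k)
    jobs-bounded = concat⁺ (map⁺ (tabulate⁺ λ r → map⁺ (jobsOnGroup-bounds (group r) (group-≤ r))))

  ∑-on-machine : ∀ r (h : ℕ → ℕ) →
                 ∑[ j < n ] (if does (σ j ≟ r) then h (exponent j) else 0) ≡ sum (map h (jobsOnGroup k (group r)))
  ∑-on-machine r h = begin
    ∑[ j < n ] F (lookup (jobList k) j)                              ≡⟨ sum-map-lookup (jobList k) F ⟩
    sum (map F (jobList k))                                          ≡⟨ sum-map-concatMap F jobsOn (allFin m) ⟩
    sum (map (λ r′ → sum (map F (jobsOn r′))) (allFin m))            ≡⟨ cong sum (map-cong on (allFin m)) ⟩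
    sum (map (λ r′ → if does (r′ ≟ r) then H r′ else 0) (allFin m)) ≡⟨ sum-map-tabulate (λ r′ → if does (r′ ≟ r) then H r′ else 0) id ⟩
    ∑[ r′ < m ] (if does (r′ ≟ r) then H r′ else 0)                  ≡⟨ ∑-indicatorˡ r H ⟩
    H r                                                              ∎
    where
    open ≡-Reasoning
    F : ℕ × Fin m → ℕ
    F x = if does (proj₂ x ≟ r) then h (proj₁ x) else 0
    jobsOn : Fin m → List (ℕ × Fin m)
    jobsOn r′ = map (λ e → e , r′) (jobsOnGroup k (group r′))
    H : Fin m → ℕ
    H r′ = sum (map h (jobsOnGroup k (group r′)))
    on : ∀ r′ → sum (map F (jobsOn r′)) ≡ (if does (r′ ≟ r) then H r′ else 0)
    on r′ = trans (cong sum (sym (map-∘ {g = F} {f = λ e → e , r′} (jobsOnGroup k (group r′)))))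
                  (sum-map-if (does (r′ ≟ r)) h (jobsOnGroup k (group r′)))

  sum-jobsOnGroup : ∀ g (h : ℕ → ℕ) →
                    sum (map h (jobsOnGroup k g)) ≡ 2 * h g + ∑[ d < k ∸ g ] (2 ^ suc (toℕ d) * h (g + suc (toℕ d)))
  sum-jobsOnGroup g h = begin
    sum (map h (replicate 2 g ++ upper))                       ≡⟨ cong sum (map-++ h (replicate 2 g) upper) ⟩
    sum (map h (replicate 2 g) ++ map h upper)                 ≡⟨ sum-++ (map h (replicate 2 g)) (map h upper) ⟩
    sum (map h (replicate 2 g)) + sum (map h upper)            ≡⟨ cong₂ _+_ (sum-map-replicate h 2 g) (sum-map-concatMap h copies groups) ⟩
    2 * h g + sum (map (λ i → sum (map h (copies i))) groups)
      ≡⟨ cong (2 * h g +_) (cong sum (map-cong (λ i → sum-map-replicate h (2 ^ (i ∸ g)) i) groups)) ⟩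
    2 * h g + sum (map (λ i → 2 ^ (i ∸ g) * h i) groups)
      ≡⟨ cong (2 * h g +_) (sum-map-applyUpTo (λ i → 2 ^ (i ∸ g) * h i) (suc g +_) (k ∸ g)) ⟩
    2 * h g + ∑[ d < k ∸ g ] (2 ^ (suc g + toℕ d ∸ g) * h (suc g + toℕ d))
      ≡⟨ cong (2 * h g +_) (sum-cong-≗ {k ∸ g} λ d → trans (cong (λ x → 2 ^ (x ∸ g) * h x) (sym (+-suc g (toℕ d))))
                                                               (cong (λ x → 2 ^ x * h (g + suc (toℕ d))) (m+n∸m≡n g (suc (toℕ d))))) ⟩
    2 * h g + ∑[ d < k ∸ g ] (2 ^ suc (toℕ d) * h (g + suc (toℕ d))) ∎
    where
    open ≡-Reasoning
    copies : ℕ → List ℕ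
    copies i = replicate (2 ^ (i ∸ g)) i
    groups upper : List ℕ
    groups = applyUpTo (suc g +_) (k ∸ g)
    upper = concatMap copies groups

  equiLoad-σ : ∀ r p → equiLoad σ r p ≡ machineLoad (k ∸ group r) p
  equiLoad-σ r p = begin
    equiLoad σ r p                                                                ≡⟨ ∑-on-machine r h ⟩
    sum (map h (jobsOnGroup k (group r)))                                         ≡⟨ sum-jobsOnGroup (group r) h ⟩
    2 * h (group r) + ∑[ d < k ∸ group r ] (2 ^ suc (toℕ d) * h (group r + suc (toℕ d)))
      ≡⟨ cong (2 * h (group r) +_) (sum-cong-≗ {k ∸ group r} λ d →
           cong (λ x → 2 ^ suc (toℕ d) * (p ⊓ 2 ^ x)) (∸-+-assoc k (group r) (suc (toℕ d)))) ⟨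
    machineLoad (k ∸ group r) p                                                   ∎
    where
    open ≡-Reasoning
    h : ℕ → ℕ
    h e = p ⊓ 2 ^ (k ∸ e)

  equiCost-σ : ∀ j → equiCost σ j ≡ (k ∸ exponent j + 2) * 2 ^ k
  equiCost-σ j = begin
    equiLoad σ (σ j) (2 ^ b) * 2 ^ g        ≡⟨ cong (_* 2 ^ g) (equiLoad-σ (σ j) (2 ^ b)) ⟩
    machineLoad (k ∸ g) (2 ^ b) * 2 ^ g     ≡⟨ cong (_* 2 ^ g) (machineLoad-own (k ∸ g) b (∸-monoʳ-≤ k g≤e)) ⟩
    (b + 2) * 2 ^ (k ∸ g) * 2 ^ g           ≡⟨ *-assoc (b + 2) (2 ^ (k ∸ g)) (2 ^ g) ⟩
    (b + 2) * (2 ^ (k ∸ g) * 2 ^ g)         ≡⟨ cong ((b + 2) *_) (2^[k∸g]*2^g (group-≤ (σ j))) ⟩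
    (b + 2) * 2 ^ k                         ∎
    where
    open ≡-Reasoning
    b g : ℕ
    b = k ∸ exponent j
    g = group (σ j)
    g≤e : g ≤ exponent j
    g≤e = proj₁ (job-bounds j)

  capacity : Fin m → ℕ
  capacity r = 2 ^ (k ∸ group r)

  fits : ∀ j → size j ≤ capacity (σ j)
  fits j = ^-monoʳ-≤ 2 (∸-monoʳ-≤ k (proj₁ (job-bounds j)))

  margin : ∀ r j → equiCost σ j + (size j ⊓ capacity r) * slowdown r ≤ (equiLoad σ r (size j) + size j) * slowdown r
  margin r j = begin
    equiCost σ j + (2 ^ b ⊓ 2 ^ q) * 2 ^ g                      ≡⟨ cong (_+ (2 ^ b ⊓ 2 ^ q) * 2 ^ g) (equiCost-σ j) ⟩
    (b + 2) * 2 ^ k + (2 ^ b ⊓ 2 ^ q) * 2 ^ g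
      ≡⟨ cong (λ x → (b + 2) * x + (2 ^ b ⊓ 2 ^ q) * 2 ^ g) (2^[k∸g]*2^g (group-≤ r)) ⟨
    (b + 2) * (2 ^ q * 2 ^ g) + (2 ^ b ⊓ 2 ^ q) * 2 ^ g         ≡⟨ cong (_+ (2 ^ b ⊓ 2 ^ q) * 2 ^ g) (*-assoc (b + 2) (2 ^ q) (2 ^ g)) ⟨
    (b + 2) * 2 ^ q * 2 ^ g + (2 ^ b ⊓ 2 ^ q) * 2 ^ g           ≡⟨ *-distribʳ-+ (2 ^ g) ((b + 2) * 2 ^ q) (2 ^ b ⊓ 2 ^ q) ⟨
    ((b + 2) * 2 ^ q + (2 ^ b ⊓ 2 ^ q)) * 2 ^ g                 ≤⟨ *-monoˡ-≤ (2 ^ g) (deviation-margin q b) ⟩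
    (machineLoad q (2 ^ b) + 2 ^ b) * 2 ^ g                     ≡⟨ cong (λ x → (x + 2 ^ b) * 2 ^ g) (equiLoad-σ r (2 ^ b)) ⟨
    (equiLoad σ r (2 ^ b) + 2 ^ b) * 2 ^ g                      ∎
    where
    open ≤-Reasoning
    b g q : ℕ
    b = k ∸ exponent j
    g = group r
    q = k ∸ g

  private
    u : ℚ
    u = halfPow k
    instance
      u≥0 : ℚ.NonNegative u
      u≥0 = ℚ.pos⇒nonNeg u {{halfPow-pos k}}

  cost-in-units : ∀ τ i → cost (inst k) τ i ≡ equiCost τ i · u
  cost-in-units τ i = begin
    cost (inst k) τ i
      ≡⟨ cong₂ ℚ._*_ (sumFin-· u n _ shares) (1/halfPow g {{ℚ.pos⇒nonZero (halfPow g) {{halfPow-pos g}}}}) ⟩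
    (L · u) ℚ.* (2 ^ g · 1ℚ)                 ≡⟨ ×-comm-* (2 ^ g) (L · u) 1ℚ ⟩
    2 ^ g · ((L · u) ℚ.* 1ℚ)                 ≡⟨ cong (2 ^ g ·_) (ℚ.*-identityʳ (L · u)) ⟩
    2 ^ g · (L · u)                          ≡⟨ ×-assocˡ u (2 ^ g) L ⟩
    (2 ^ g * L) · u                          ≡⟨ cong (_· u) (*-comm (2 ^ g) L) ⟩
    equiCost τ i · u                         ∎
    where
    open ≡-Reasoning
    g L : ℕ
    g = group (τ i)
    L = equiLoad τ (τ i) (size i)
    shares : ∀ j → (if does (τ j ≟ τ i) then halfPow (exponent i) ℚ.⊓ halfPow (exponent j) else 0ℚ)
                   ≡ (if does (τ j ≟ τ i) then size i ⊓ size j else 0) · u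
    shares j with does (τ j ≟ τ i)
    ... | true  = trans (cong₂ ℚ._⊓_ (halfPow-in-units (proj₂ (job-bounds i))) (halfPow-in-units (proj₂ (job-bounds j))))
                        (·-distrib-⊓ u (size i) (size j))
    ... | false = refl

  strongNE : StrongNE (inst k) σ
  strongNE C σ′ member stay improves =
    strongNE-criterion capacity σ fits margin C σ′ member stay λ i i∈C →
      ·-cancelʳ-< u (subst₂ ℚ._<_ (cost-in-units σ′ i) (cost-in-units σ i) (improves i i∈C))

lemma9 : (k : ℕ) → 1 ≤ k → StrongNE (inst k) (sigma k)
-- The construction is a strong equilibrium for k = 0 as well.
lemma9 k _ = Construction.strongNE k
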